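{- Let $B=B'(p)$ and let $m$ be an arbitrary decreasingly minimal element of $B\cap\mathbb{Z}^S$. Let $\beta_1$ be the largest value of $m$ and $C_1$ the smallest $m$-tight set containing all elements $s$ with $m(s)=\beta_1$. For $i=2,3,\dots$, as long as $C_{i-1}\neq S$, let $\beta_i$ be the largest value of $m$ on $S-C_{i-1}$ and $C_i$ the smallest $m$-tight set containing every element of $m$-value at least $\beta_i$; let $q$ be the index with $C_q=S$. Then the chain $C_1\subset C_2\subset\cdots\subset C_q$ and the sequence $\beta_1>\beta_2>\cdots>\beta_q$ do not depend on the choice of $m$.
   Context: $S$ is a finite non-empty set; $p$ is a set-function on subsets of $S$ with values in $\mathbb{Z}\cup\{ -\infty\}$, $p(\emptyset)=0$, $p(S)$ finite, and supermodular: $p(X)+p(Y)\le p(X\cap Y)+p(X\cup Y)$ whenever $p(X),p(Y)$ are finite. $B'(p)=\{x\in\mathbb{R}^S:\widetilde x(S)=p(S),\ \widetilde x(Z)\ge p(Z)\ \forall Z\subset S\}$, $\widetilde x(Z)=\sum_{s\in Z}x(s)$. For $m\in B\cap\mathbb{Z}^S$, a set $X$ is $m$-tight if $\widetilde m(X)=p(X)$; $m$-tight sets are closed under union and intersection, so for any $Z\subseteq S$ there is a unique smallest $m$-tight set containing $Z$. With $x{\downarrow}$ the decreasing rearrangement of $x$, $m$ is decreasingly minimal in $B\cap\mathbb{Z}^S$ if for every $y$ in it, $m{\downarrow}=y{\downarrow}$ or $m{\downarrow}(j)<y{\downarrow}(j)$ at the first index where they differ. -}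

module Defs where

open import Data.Nat using (ℕ; zero; suc; _∸_) renaming (_<_ to _<ℕ_; _≤_ to _≤ℕ_)
open import Data.Integer using (ℤ; _+_; _≤_; _<_; 0ℤ)
import Data.Integer.Properties as ℤP
open import Data.Fin using (Fin)
open import Data.Fin.Subset using (Subset; Side; inside; outside; _∈_; _∉_; _⊆_; _∩_; _∪_; ⊤; ⊥)
open import Data.Vec using ([]; _∷_)
open import Data.List using (List; []; _∷_; reverse; tabulate)
open import Data.Product using (Σ; ∃; _×_)
open import Relation.Binary.PropositionalEquality using (_≡_; _≢_)
open import Data.List.Sort ℤP.≤-decTotalOrder using (sort)

data ℤ∞ : Set where
  -∞  : ℤ∞
  fin : ℤ → ℤ∞

_+∞_ : ℤ∞ → ℤ∞ → ℤ∞
-∞    +∞ _     = -∞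
fin a +∞ -∞    = -∞
fin a +∞ fin b = fin (a + b)

data _≤∞_ : ℤ∞ → ℤ∞ → Set where
  -∞≤     : ∀ {x} → -∞ ≤∞ x
  fin≤fin : ∀ {a b} → a ≤ b → fin a ≤∞ fin b

sumOver : ∀ {n} → Subset n → (Fin n → ℤ) → ℤ
sumOver {zero}  []            x = 0ℤ
sumOver {suc n} (inside ∷ Z)  x = x Fin.zero + sumOver Z (λ i → x (Fin.suc i))
sumOver {suc n} (outside ∷ Z) x = sumOver Z (λ i → x (Fin.suc i))

record IsAdmissible {n : ℕ} (p : Subset n → ℤ∞) : Set where
  field
    p-empty   : p ⊥ ≡ fin 0ℤ
    p-S-fin   : ∃ λ k → p ⊤ ≡ fin k
    supermod  : ∀ X Y a b → p X ≡ fin a → p Y ≡ fin b →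
                fin (a + b) ≤∞ (p (X ∩ Y) +∞ p (X ∪ Y))

InB : ∀ {n} → (Subset n → ℤ∞) → (Fin n → ℤ) → Set
InB p x = (p ⊤ ≡ fin (sumOver ⊤ x)) × (∀ Z → p Z ≤∞ fin (sumOver Z x))

dec↓ : ∀ {n} → (Fin n → ℤ) → List ℤ
dec↓ x = reverse (sort (tabulate x))

data LexDecLe : List ℤ → List ℤ → Set where
  lex-[] : LexDecLe [] []
  lex-<  : ∀ {a b as bs} → a < b → LexDecLe (a ∷ as) (b ∷ bs)
  lex-≡  : ∀ {a as bs} → LexDecLe as bs → LexDecLe (a ∷ as) (a ∷ bs)

DecMin : ∀ {n} → (Subset n → ℤ∞) → (Fin n → ℤ) → Set
DecMin p m = InB p m × (∀ y → InB p y → LexDecLe (dec↓ m) (dec↓ y))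

Tight : ∀ {n} → (Subset n → ℤ∞) → (Fin n → ℤ) → Subset n → Set
Tight p m X = p X ≡ fin (sumOver X m)

SmallestTight : ∀ {n} → (Subset n → ℤ∞) → (Fin n → ℤ) → (Fin n → Set) → Subset n → Set
SmallestTight {n} p m P C =
  Tight p m C × (∀ s → P s → s ∈ C) ×
  (∀ (T : Subset n) → Tight p m T → (∀ s → P s → s ∈ T) → C ⊆ T)

IsMaxOn : ∀ {n} → (Fin n → Set) → (Fin n → ℤ) → ℤ → Set
IsMaxOn P m β = (∃ λ s → P s × m s ≡ β) × (∀ s → P s → m s ≤ β)

-- The chain C_1 ⊂ … ⊂ C_q and values β_1 > … > β_q constructed from m,
-- indexed from 0: C i = C_{i+1}, β i = β_{i+1}, for i < q.
record IsChain {n : ℕ} (p : Subset n → ℤ∞) (m : Fin n → ℤ)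
               (q : ℕ) (C : ℕ → Subset n) (β : ℕ → ℤ) : Set where
  field
    q-pos   : 1 ≤ℕ q
    β-first : IsMaxOn (λ s → s ∈ ⊤) m (β 0)
    C-first : SmallestTight p m (λ s → m s ≡ β 0) (C 0)
    C-notS  : ∀ i → suc i <ℕ q → C i ≢ ⊤
    β-step  : ∀ i → suc i <ℕ q → IsMaxOn (λ s → s ∉ C i) m (β (suc i))
    C-step  : ∀ i → suc i <ℕ q → SmallestTight p m (λ s → β (suc i) ≤ m s) (C (suc i))
    C-last  : C (q ∸ 1) ≡ ⊤

-- Two decreasingly minimal elements m, m′ have the same decreasing rearrangement, so for every k
-- they have equally many elements of value ≥ k.  Induct along the chains, assuming the previous
-- sets agree: D = C_{i-1} = C′_{i-1}.  As D is tight for both, m(D) = p(D) = m′(D), and β_i is the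
-- largest k for which more than |D| elements have value ≥ k, so β_i = β′_i.  If some s ∈ C_i had
-- m(s) + 1 < β_i, then every t with m(t) ≥ β_i would lie in a tight set avoiding s (otherwise
-- m − χ_t + χ_s stays in B and is decreasingly smaller), and the union of these sets would be a
-- tight set containing {m ≥ β_i} but not s ∈ C_i.  Hence m ≥ β_i − 1 on C_i, and comparing m with m′
-- elementwise there gives m′(C_i) ≤ m(C_i) = p(C_i): C_i is m′-tight and contains {m′ ≥ β_i}, so
-- C′_i ⊆ C_i, and by symmetry C_i = C′_i.  Equal chains reach S at the same index.

module Submission where

open import Defs
open import Data.Bool using (true; false; _∧_; _∨_; if_then_else_)
open import Data.Empty using (⊥-elim)
open import Data.Fin using (Fin; zero; suc; _≟_)
open import Data.Fin.Subset using (Subset; ⋃; _∈_; _∉_; _⊆_; _∩_; _∪_; ⊤; ⊥)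
open import Data.Fin.Subset.Properties using (∈⊤; ∉⊥; _∈?_; x∈p∪q⁺; x∈p∪q⁻; anySubset?; ⊆-antisym)
open import Data.Integer
  using (ℤ; _+_; _-_; -_; _≤_; _<_; _≥_; 0ℤ; 1ℤ; pred; _≤?_; _<?_; +≤+; +<+)
  renaming (suc to sucℤ)
open import Data.Integer.Properties
  using (+-0-abelianGroup; +-0-commutativeMonoid; +-0-isCommutativeMonoid; +-commutativeSemigroup;
         ≤-decTotalOrder; ≤-refl; ≤-trans; ≤-antisym; ≤-reflexive; <-trans; <-≤-trans; ≤-<-trans;
         <-irrefl; <-asym; <⇒≤; <⇒≱; ≤⇒≯; ≰⇒>; ≮⇒≥; ≤∧≢⇒<;
         i≤suc[i]; i<j⇒suc[i]≤j; suc[i]≤j⇒i<j; i≤pred[j]⇒i<j;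
         +-comm; +-identityˡ; +-identityʳ; +-monoʳ-≤; +-monoˡ-≤; +-monoʳ-<; +-mono-≤; +-mono-<-≤;
         +-mono-≤-<; module ≤-Reasoning)
  renaming (_≟_ to _≟ℤ_)
open import Algebra.Properties.AbelianGroup +-0-abelianGroup using (∙-cancelˡ)
open import Algebra.Properties.CommutativeMonoid.Sum +-0-commutativeMonoid
  using (sum; ∑-distrib-+; sum-cong-≗)
open import Algebra.Properties.CommutativeSemigroup +-commutativeSemigroup
  using (interchange)
open import Data.Integer.Tactic.RingSolver using (solve-∀)
open import Data.List using (List; []; _∷_; foldr; map; reverse; tabulate)
open import Data.List.Properties using (unfold-reverse)
open import Data.List.Relation.Unary.All as All using (All; []; _∷_)
import Data.List.Relation.Unary.All.Properties as All
open import Data.List.Relation.Unary.AllPairs using (AllPairs; []; _∷_)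
import Data.List.Relation.Unary.AllPairs.Properties as AllPairs
open import Data.List.Relation.Unary.Any using (Any; here; there)
import Data.List.Relation.Unary.Any.Properties as Any
open import Data.List.Relation.Unary.Linked.Properties using (Linked⇒AllPairs)
open import Data.List.Relation.Binary.Permutation.Propositional using (_↭_; ↭-sym; ↭⇒↭ₛ)
open import Data.List.Relation.Binary.Permutation.Propositional.Properties
  using (map⁺; ↭-reverse; All-resp-↭)
open import Data.List.Relation.Binary.Permutation.Setoid.Properties using (foldr-commMonoid)
open import Data.List.Sort ≤-decTotalOrder using (sort; sort-↭; sort-↗)
open import Data.Nat using (ℕ; zero; suc; z≤n; s≤s) renaming (_<_ to _<ℕ_; _≤_ to _≤ℕ_)
import Data.Nat.Properties as ℕ
open import Data.Product using (Σ; ∃; _×_; _,_; proj₁; proj₂)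
open import Data.Sum using (_⊎_; inj₁; inj₂)
open import Data.Vec using ([]; _∷_; lookup)
open import Data.Vec.Properties using ([]=⇒lookup; lookup⇒[]=; lookup-zipWith)
open import Function using (const; flip; _∘_)
open import Relation.Binary.Core using (Rel)
open import Relation.Binary.PropositionalEquality
  using (_≡_; _≢_; refl; sym; trans; cong; cong₂; subst; subst₂; setoid; module ≡-Reasoning)
open import Relation.Nullary using (¬_; yes; no; Dec; contradiction)
open import Relation.Nullary.Decidable using (_×-dec_; ¬?; map′)
open import Relation.Unary using (Pred; Decidable)

private
  variable
    n : ℕ

-a+[a+b]≡b : ∀ a b → - a + (a + b) ≡ b
-a+[a+b]≡b = solve-∀

+-cancelˡ-≤ : ∀ a {b c} → a + b ≤ a + c → b ≤ c
+-cancelˡ-≤ a {b} {c} h = subst₂ _≤_ (-a+[a+b]≡b a b) (-a+[a+b]≡b a c) (+-monoʳ-≤ (- a) h)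

+-cancelˡ-< : ∀ a {b c} → a + b < a + c → b < c
+-cancelˡ-< a {b} {c} h = subst₂ _<_ (-a+[a+b]≡b a b) (-a+[a+b]≡b a c) (+-monoʳ-< (- a) h)

fin-injective : ∀ {a b} → fin a ≡ fin b → a ≡ b
fin-injective refl = refl

≡fin? : (a : ℤ∞) (v : ℤ) → Dec (a ≡ fin v)
≡fin? -∞      v = no λ ()
≡fin? (fin a) v = map′ (cong fin) fin-injective (a ≟ℤ v)

drop‿fin≤fin : ∀ {a b} → fin a ≤∞ fin b → a ≤ b
drop‿fin≤fin (fin≤fin a≤b) = a≤b

≤∞-fin-trans : ∀ {a x y} → a ≤∞ fin x → x ≤ y → a ≤∞ fin y
≤∞-fin-trans -∞≤         x≤y = -∞≤
≤∞-fin-trans (fin≤fin a≤x) x≤y = fin≤fin (≤-trans a≤x x≤y)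

≤∞-fin-suc : ∀ {a x} → a ≤∞ fin (sucℤ x) → a ≢ fin (sucℤ x) → a ≤∞ fin x
≤∞-fin-suc -∞≤            _  = -∞≤
≤∞-fin-suc (fin≤fin c≤1+x) c≢1+x =
  fin≤fin (+-cancelˡ-≤ 1ℤ (i<j⇒suc[i]≤j (≤∧≢⇒< c≤1+x (λ c≡1+x → c≢1+x (cong fin c≡1+x)))))

≤∞-sum-squeeze : ∀ {s c d x y} → fin s ≤∞ (c +∞ d) → c ≤∞ fin x → d ≤∞ fin y → x + y ≡ s → d ≡ fin y
≤∞-sum-squeeze {c = -∞}    ()
≤∞-sum-squeeze {c = fin _} {d = -∞} ()
≤∞-sum-squeeze {c = fin c} {d = fin d} {x} (fin≤fin s≤c+d) (fin≤fin c≤x) (fin≤fin d≤y) refl =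
  cong fin (≤-antisym d≤y (+-cancelˡ-≤ x (≤-trans s≤c+d (+-monoˡ-≤ d c≤x))))

restrict : Subset n → (Fin n → ℤ) → Fin n → ℤ
restrict X f s = if lookup X s then f s else 0ℤ

module _ {X : Subset n} {s : Fin n} (f : Fin n → ℤ) where

  restrict-∈ : s ∈ X → restrict X f s ≡ f s
  restrict-∈ s∈X rewrite []=⇒lookup s∈X = refl

  restrict-∉ : s ∉ X → restrict X f s ≡ 0ℤ
  restrict-∉ s∉X with lookup X s in eq
  ... | true  = ⊥-elim (s∉X (lookup⇒[]= s X eq))
  ... | false = refl

χ : Subset n → Fin n → ℤ
χ X = restrict X (const 1ℤ)

χ-∈ : ∀ {X : Subset n} {s} → s ∈ X → χ X s ≡ 1ℤ
χ-∈ = restrict-∈ (const 1ℤ)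

χ-∉ : ∀ {X : Subset n} {s} → s ∉ X → χ X s ≡ 0ℤ
χ-∉ = restrict-∉ (const 1ℤ)

sumOver-restrict : ∀ (X : Subset n) f → sumOver X f ≡ sum (restrict X f)
sumOver-restrict []          f = refl
sumOver-restrict (true ∷ X)  f = cong (f zero +_) (sumOver-restrict X (λ i → f (suc i)))
sumOver-restrict (false ∷ X) f =
  trans (sumOver-restrict X (λ i → f (suc i))) (sym (+-identityˡ _))

sumOver-⊥ : ∀ (f : Fin n → ℤ) → sumOver ⊥ f ≡ 0ℤ
sumOver-⊥ {zero}  f = refl
sumOver-⊥ {suc n} f = sumOver-⊥ (λ i → f (suc i))

sumOver-cong : ∀ (X : Subset n) {f g} → (∀ i → f i ≡ g i) → sumOver X f ≡ sumOver X g
sumOver-cong []          f≗g = refl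
sumOver-cong (true ∷ X)  f≗g = cong₂ _+_ (f≗g zero) (sumOver-cong X (λ i → f≗g (suc i)))
sumOver-cong (false ∷ X) f≗g = sumOver-cong X (λ i → f≗g (suc i))

sumOver-+ : ∀ (X : Subset n) f g → sumOver X (λ i → f i + g i) ≡ sumOver X f + sumOver X g
sumOver-+ []          f g = refl
sumOver-+ (true ∷ X)  f g =
  trans (cong (f zero + g zero +_) (sumOver-+ X _ _)) (interchange (f zero) (g zero) _ _)
sumOver-+ (false ∷ X) f g = sumOver-+ X _ _

sumOver-0 : ∀ (X : Subset n) → sumOver X (const 0ℤ) ≡ 0ℤ
sumOver-0 []          = refl
sumOver-0 (true ∷ X)  = trans (+-identityˡ _) (sumOver-0 X)
sumOver-0 (false ∷ X) = sumOver-0 X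

restrict-modular : ∀ (X Y : Subset n) f s →
  restrict (X ∩ Y) f s + restrict (X ∪ Y) f s ≡ restrict X f s + restrict Y f s
restrict-modular X Y f s
  rewrite lookup-zipWith _∧_ s X Y | lookup-zipWith _∨_ s X Y
  with lookup X s | lookup Y s
... | true  | true  = refl
... | true  | false = +-comm 0ℤ (f s)
... | false | true  = refl
... | false | false = refl

sumOver-modular : ∀ (X Y : Subset n) f →
  sumOver (X ∩ Y) f + sumOver (X ∪ Y) f ≡ sumOver X f + sumOver Y f
sumOver-modular X Y f = begin
  sumOver (X ∩ Y) f + sumOver (X ∪ Y) f
    ≡⟨ cong₂ _+_ (sumOver-restrict (X ∩ Y) f) (sumOver-restrict (X ∪ Y) f) ⟩
  sum (restrict (X ∩ Y) f) + sum (restrict (X ∪ Y) f)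
    ≡⟨ sym (∑-distrib-+ (restrict (X ∩ Y) f) (restrict (X ∪ Y) f)) ⟩
  sum (λ s → restrict (X ∩ Y) f s + restrict (X ∪ Y) f s)
    ≡⟨ sum-cong-≗ (restrict-modular X Y f) ⟩
  sum (λ s → restrict X f s + restrict Y f s)
    ≡⟨ ∑-distrib-+ (restrict X f) (restrict Y f) ⟩
  sum (restrict X f) + sum (restrict Y f)
    ≡⟨ sym (cong₂ _+_ (sumOver-restrict X f) (sumOver-restrict Y f)) ⟩
  sumOver X f + sumOver Y f ∎
  where open ≡-Reasoning

sum-mono-≤ : ∀ {f g : Fin n → ℤ} → (∀ i → f i ≤ g i) → sum f ≤ sum g
sum-mono-≤ {zero}  f≤g = ≤-refl
sum-mono-≤ {suc n} f≤g = +-mono-≤ (f≤g zero) (sum-mono-≤ (λ i → f≤g (suc i)))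

sum-mono-< : ∀ {f g : Fin n → ℤ} → (∀ i → f i ≤ g i) → ∀ j → f j < g j → sum f < sum g
sum-mono-< f≤g zero    fj<gj = +-mono-<-≤ fj<gj (sum-mono-≤ (λ i → f≤g (suc i)))
sum-mono-< f≤g (suc j) fj<gj = +-mono-≤-< (f≤g zero) (sum-mono-< (λ i → f≤g (suc i)) j fj<gj)

unit : Fin n → Fin n → ℤ
unit zero    zero    = 1ℤ
unit zero    (suc _) = 0ℤ
unit (suc _) zero    = 0ℤ
unit (suc t) (suc u) = unit t u

unit-same : ∀ (t : Fin n) → unit t t ≡ 1ℤ
unit-same zero    = refl
unit-same (suc t) = unit-same t

unit-other : ∀ {t u : Fin n} → u ≢ t → unit t u ≡ 0ℤ
unit-other {t = zero}  {zero}  u≢t = ⊥-elim (u≢t refl)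
unit-other {t = zero}  {suc u} u≢t = refl
unit-other {t = suc t} {zero}  u≢t = refl
unit-other {t = suc t} {suc u} u≢t = unit-other (λ u≡t → u≢t (cong suc u≡t))

sumOver-unit : ∀ (X : Subset n) t → sumOver X (unit t) ≡ χ X t
sumOver-unit (true ∷ X)  zero    = cong (1ℤ +_) (sumOver-0 X)
sumOver-unit (false ∷ X) zero    = sumOver-0 X
sumOver-unit (true ∷ X)  (suc t) = trans (+-identityˡ _) (sumOver-unit X t)
sumOver-unit (false ∷ X) (suc t) = sumOver-unit X t

-- Level counts and the decreasing order

atLeast : ℤ → ℤ → ℤ
atLeast k a with k ≤? a
... | yes _ = 1ℤ
... | no  _ = 0ℤ

module _ {k a : ℤ} where

  atLeast-≤ : k ≤ a → atLeast k a ≡ 1ℤ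
  atLeast-≤ k≤a with k ≤? a
  ... | yes _   = refl
  ... | no  k≰a = ⊥-elim (k≰a k≤a)

  atLeast-< : a < k → atLeast k a ≡ 0ℤ
  atLeast-< a<k with k ≤? a
  ... | yes k≤a = ⊥-elim (<⇒≱ a<k k≤a)
  ... | no  _   = refl

  atLeast-nonneg : 0ℤ ≤ atLeast k a
  atLeast-nonneg with k ≤? a
  ... | yes _ = +≤+ z≤n
  ... | no  _ = ≤-refl

  atLeast-≤1 : atLeast k a ≤ 1ℤ
  atLeast-≤1 with k ≤? a
  ... | yes _ = ≤-refl
  ... | no  _ = +≤+ z≤n

atLeast-exchange : ∀ {β x y} → x ≤ β → β ≤ sucℤ y → atLeast β y + x ≤ atLeast β x + y
atLeast-exchange {β} {x} {y} x≤β β≤1+y with β ≤? x | β ≤? y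
... | yes _    | yes β≤y = +-monoʳ-≤ 1ℤ (≤-trans x≤β β≤y)
... | yes _    | no  _   = subst (_≤ 1ℤ + y) (sym (+-identityˡ x)) (≤-trans x≤β β≤1+y)
... | no  β≰x | yes β≤y = subst (1ℤ + x ≤_) (sym (+-identityˡ y)) (≤-trans (i<j⇒suc[i]≤j (≰⇒> β≰x)) β≤y)
... | no  β≰x | no  _   = subst₂ _≤_ (sym (+-identityˡ x)) (sym (+-identityˡ y))
  (+-cancelˡ-≤ 1ℤ (≤-trans (i<j⇒suc[i]≤j (≰⇒> β≰x)) β≤1+y))

count≥ : ℤ → (Fin n → ℤ) → ℤ
count≥ k x = sum (λ s → atLeast k (x s))

count≥ᴸ : ℤ → List ℤ → ℤ
count≥ᴸ k xs = foldr _+_ 0ℤ (map (atLeast k) xs)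

count≥ᴸ-↭ : ∀ k {xs ys} → xs ↭ ys → count≥ᴸ k xs ≡ count≥ᴸ k ys
count≥ᴸ-↭ k xs↭ys =
  foldr-commMonoid (setoid ℤ) +-0-isCommutativeMonoid (↭⇒↭ₛ (map⁺ (atLeast k) xs↭ys))

count≥ᴸ-tabulate : ∀ k (x : Fin n → ℤ) → count≥ᴸ k (tabulate x) ≡ count≥ k x
count≥ᴸ-tabulate {zero}  k x = refl
count≥ᴸ-tabulate {suc n} k x = cong (atLeast k (x zero) +_) (count≥ᴸ-tabulate k (λ i → x (suc i)))

count≥ᴸ-dec↓ : ∀ k (x : Fin n → ℤ) → count≥ᴸ k (dec↓ x) ≡ count≥ k x
count≥ᴸ-dec↓ k x = trans (count≥ᴸ-↭ k (↭-reverse (sort (tabulate x))))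
                 (trans (count≥ᴸ-↭ k (sort-↭ (tabulate x))) (count≥ᴸ-tabulate k x))

count≥ᴸ-nonneg : ∀ k xs → 0ℤ ≤ count≥ᴸ k xs
count≥ᴸ-nonneg k []       = ≤-refl
count≥ᴸ-nonneg k (a ∷ xs) = +-mono-≤ (atLeast-nonneg {k} {a}) (count≥ᴸ-nonneg k xs)

count≥ᴸ-below : ∀ {k xs} → All (_< k) xs → count≥ᴸ k xs ≡ 0ℤ
count≥ᴸ-below []            = refl
count≥ᴸ-below (a<k ∷ xs<k) rewrite atLeast-< a<k | count≥ᴸ-below xs<k = refl

AllPairs-reverse : ∀ {a ℓ} {A : Set a} {R : Rel A ℓ} {xs} → AllPairs R xs → AllPairs (flip R) (reverse xs)
AllPairs-reverse {xs = []}     []          = []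
AllPairs-reverse {xs = x ∷ xs} (Rx ∷ Rxs) rewrite unfold-reverse x xs =
  AllPairs.++⁺ (AllPairs-reverse Rxs) ([] ∷ [])
    (All.map (_∷ []) (All-resp-↭ (↭-sym (↭-reverse xs)) Rx))

Descending : List ℤ → Set
Descending = AllPairs _≥_

dec↓-descending : (x : Fin n → ℤ) → Descending (dec↓ x)
dec↓-descending x = AllPairs-reverse (Linked⇒AllPairs ≤-trans (sort-↗ (tabulate x)))

LexDecLe-antisym : ∀ {xs ys} → LexDecLe xs ys → LexDecLe ys xs → xs ≡ ys
LexDecLe-antisym lex-[]     lex-[]     = refl
LexDecLe-antisym (lex-< a<b) (lex-< b<a) = ⊥-elim (<-asym a<b b<a)
LexDecLe-antisym (lex-< a<a) (lex-≡ _)   = ⊥-elim (<-irrefl refl a<a)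
LexDecLe-antisym (lex-≡ _)   (lex-< a<a) = ⊥-elim (<-irrefl refl a<a)
LexDecLe-antisym (lex-≡ le)  (lex-≡ ge)  = cong (_ ∷_) (LexDecLe-antisym le ge)

LexDecLe-noCountDrop : ∀ {xs ys} → LexDecLe xs ys → Descending xs → ∀ k →
  (∀ j → k < j → count≥ᴸ j ys ≡ count≥ᴸ j xs) → ¬ count≥ᴸ k ys < count≥ᴸ k xs
LexDecLe-noCountDrop lex-[] _ k _ = <-irrefl refl
LexDecLe-noCountDrop {a ∷ xs} {b ∷ ys} (lex-< a<b) (xs≤a ∷ _) k same drop with k <? b
... | yes k<b = <-irrefl (sym (same b k<b)) (begin-strict
  count≥ᴸ b (a ∷ xs)   ≡⟨ count≥ᴸ-below (below ≤-refl) ⟩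
  0ℤ                   <⟨ +<+ (s≤s z≤n) ⟩
  1ℤ                   ≡⟨ sym (+-identityʳ 1ℤ) ⟩
  1ℤ + 0ℤ              ≤⟨ +-mono-≤ (≤-reflexive (sym (atLeast-≤ {b} {b} ≤-refl))) (count≥ᴸ-nonneg b ys) ⟩
  count≥ᴸ b (b ∷ ys)   ∎)
  where
  open ≤-Reasoning
  below : ∀ {c} → b ≤ c → All (_< c) (a ∷ xs)
  below b≤c = <-≤-trans a<b b≤c ∷ All.map (λ x≤a → ≤-<-trans x≤a (<-≤-trans a<b b≤c)) xs≤a
... | no  k≮b = ≤⇒≯ (count≥ᴸ-nonneg k (b ∷ ys))
  (subst (count≥ᴸ k (b ∷ ys) <_) (count≥ᴸ-below below) drop)
  where
  below : All (_< k) (a ∷ xs)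
  below = <-≤-trans a<b (≮⇒≥ k≮b) ∷ All.map (λ x≤a → ≤-<-trans x≤a (<-≤-trans a<b (≮⇒≥ k≮b))) xs≤a
LexDecLe-noCountDrop {a ∷ xs} {.a ∷ ys} (lex-≡ le) (_ ∷ desc) k same drop =
  LexDecLe-noCountDrop le desc k
    (λ j k<j → ∙-cancelˡ (atLeast j a) _ _ (same j k<j))
    (+-cancelˡ-< (atLeast k a) drop)

decMin-count≥-≡ : ∀ {p : Subset n → ℤ∞} {m m′} → DecMin p m → DecMin p m′ →
  ∀ k → count≥ k m ≡ count≥ k m′
decMin-count≥-≡ {m = m} {m′} (inB , least) (inB′ , least′) k = begin
  count≥ k m           ≡⟨ count≥ᴸ-dec↓ k m ⟨
  count≥ᴸ k (dec↓ m)   ≡⟨ cong (count≥ᴸ k) (LexDecLe-antisym (least m′ inB′) (least′ m inB)) ⟩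
  count≥ᴸ k (dec↓ m′)  ≡⟨ count≥ᴸ-dec↓ k m′ ⟩
  count≥ k m′          ∎
  where open ≡-Reasoning

decMin-noCountDrop : ∀ {p : Subset n → ℤ∞} {m y} → DecMin p m → InB p y → ∀ k →
  (∀ j → k < j → count≥ j y ≡ count≥ j m) → ¬ count≥ k y < count≥ k m
decMin-noCountDrop {m = m} {y} (_ , least) inB k same drop =
  LexDecLe-noCountDrop (least y inB) (dec↓-descending m) k
    (λ j k<j → subst₂ _≡_ (sym (count≥ᴸ-dec↓ j y)) (sym (count≥ᴸ-dec↓ j m)) (same j k<j))
    (subst₂ _<_ (sym (count≥ᴸ-dec↓ k y)) (sym (count≥ᴸ-dec↓ k m)) drop)

-- Tight sets

∈-⋃⁺ : ∀ {x : Fin n} {Zs} → Any (x ∈_) Zs → x ∈ ⋃ Zs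
∈-⋃⁺ (here x∈Z)   = x∈p∪q⁺ (inj₁ x∈Z)
∈-⋃⁺ (there x∈Zs) = x∈p∪q⁺ (inj₂ (∈-⋃⁺ x∈Zs))

∉-⋃ : ∀ {x : Fin n} {Zs} → All (x ∉_) Zs → x ∉ ⋃ Zs
∉-⋃ []                = ∉⊥
∉-⋃ {Zs = Z ∷ Zs} (x∉Z ∷ x∉Zs) x∈⋃ with x∈p∪q⁻ Z (⋃ Zs) x∈⋃
... | inj₁ x∈Z  = x∉Z x∈Z
... | inj₂ x∈Zs = ∉-⋃ x∉Zs x∈Zs

smallestTight-∉⇒< : ∀ {p : Subset n → ℤ∞} {m β C s} →
  SmallestTight p m (λ s → β ≤ m s) C → s ∉ C → m s < β
smallestTight-∉⇒< (_ , ⊇β≤m , _) s∉C = ≰⇒> (λ β≤ms → s∉C (⊇β≤m _ β≤ms))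

module _ {p : Subset n → ℤ∞} (adm : IsAdmissible p) where
  open IsAdmissible adm

  tight-⊥ : ∀ m → Tight p m ⊥
  tight-⊥ m = trans p-empty (cong fin (sym (sumOver-⊥ m)))

  tight-∪ : ∀ {m X Y} → InB p m → Tight p m X → Tight p m Y → Tight p m (X ∪ Y)
  tight-∪ {m} {X} {Y} (_ , lower) tX tY =
    ≤∞-sum-squeeze (supermod X Y _ _ tX tY) (lower (X ∩ Y)) (lower (X ∪ Y)) (sumOver-modular X Y m)

  tight-⋃ : ∀ {m Zs} → InB p m → All (Tight p m) Zs → Tight p m (⋃ Zs)
  tight-⋃ {m} inB []         = tight-⊥ m
  tight-⋃     inB (tZ ∷ tZs) = tight-∪ inB tZ (tight-⋃ inB tZs)

  smallestTight-∌ : ∀ {m} {P : Pred (Fin n) _} {C s} → InB p m → Decidable P → SmallestTight p m P C →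
    (∀ t → P t → ∃ λ Z → Tight p m Z × t ∈ Z × s ∉ Z) → s ∉ C
  smallestTight-∌ {m} {P} {s = s} inB P? (_ , _ , least) separate s∈C =
    ∉-⋃ (All.tabulate⁺ s∉Z) (least (⋃ (tabulate Z)) ⋃Z-tight ⋃Z-⊇P s∈C)
    where
    separator : ∀ t → Σ (Subset n) λ Z → Tight p m Z × (P t → t ∈ Z) × s ∉ Z
    separator t with P? t
    ... | yes Pt = let Z , tZ , t∈Z , s∉Z = separate t Pt in Z , tZ , const t∈Z , s∉Z
    ... | no ¬Pt = ⊥ , tight-⊥ m , (λ Pt → contradiction Pt ¬Pt) , ∉⊥

    Z : Fin n → Subset n
    Z t = proj₁ (separator t)

    s∉Z : ∀ t → s ∉ Z t
    s∉Z t = proj₂ (proj₂ (proj₂ (separator t)))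

    ⋃Z-tight : Tight p m (⋃ (tabulate Z))
    ⋃Z-tight = tight-⋃ inB (All.tabulate⁺ (λ t → proj₁ (proj₂ (separator t))))

    ⋃Z-⊇P : ∀ t → P t → t ∈ ⋃ (tabulate Z)
    ⋃Z-⊇P t Pt = ∈-⋃⁺ (Any.tabulate⁺ t (proj₁ (proj₂ (proj₂ (separator t))) Pt))

-- Exchanging one unit

transfer : (Fin n → ℤ) → Fin n → Fin n → Fin n → ℤ
transfer m t s u = (unit s u - unit t u) + m u

sumOver-transfer : ∀ (X : Subset n) m t s →
  χ X t + sumOver X (transfer m t s) ≡ χ X s + sumOver X m
sumOver-transfer X m t s = begin
  χ X t + sumOver X (transfer m t s)
    ≡⟨ cong (_+ sumOver X (transfer m t s)) (sumOver-unit X t) ⟨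
  sumOver X (unit t) + sumOver X (transfer m t s)
    ≡⟨ sumOver-+ X (unit t) (transfer m t s) ⟨
  sumOver X (λ u → unit t u + transfer m t s u)
    ≡⟨ sumOver-cong X (λ u → moved (m u) (unit s u) (unit t u)) ⟩
  sumOver X (λ u → unit s u + m u)
    ≡⟨ sumOver-+ X (unit s) m ⟩
  sumOver X (unit s) + sumOver X m
    ≡⟨ cong (_+ sumOver X m) (sumOver-unit X s) ⟩
  χ X s + sumOver X m ∎
  where
  open ≡-Reasoning
  moved : ∀ a b c → c + ((b - c) + a) ≡ b + a
  moved = solve-∀

module _ {m : Fin n → ℤ} {t s : Fin n} where

  transfer-source : t ≢ s → transfer m t s t ≡ pred (m t)
  transfer-source t≢s rewrite unit-other {t = s} t≢s | unit-same t = refl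

  transfer-target : t ≢ s → transfer m t s s ≡ sucℤ (m s)
  transfer-target t≢s rewrite unit-same s | unit-other {t = t} (λ s≡t → t≢s (sym s≡t)) = refl

  transfer-other : ∀ {u} → u ≢ t → u ≢ s → transfer m t s u ≡ m u
  transfer-other u≢t u≢s rewrite unit-other u≢s | unit-other u≢t = +-identityˡ (m _)

  module _ (ms<mt : sucℤ (m s) < m t) where

    private
      t≢s : t ≢ s
      t≢s refl = <-irrefl refl (<-trans (suc[i]≤j⇒i<j ≤-refl) ms<mt)

    transfer-values : ∀ u → transfer m t s u ≡ m u ⊎ (transfer m t s u < m t × m u ≤ m t)
    transfer-values u with u ≟ t | u ≟ s
    ... | yes refl | _        = inj₂ (subst (_< m t) (sym (transfer-source t≢s)) (i≤pred[j]⇒i<j ≤-refl) , ≤-refl)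
    ... | no _     | yes refl = inj₂ (subst (_< m t) (sym (transfer-target t≢s)) ms<mt
                                     , ≤-trans (i≤suc[i] (m s)) (<⇒≤ ms<mt))
    ... | no u≢t   | no u≢s   = inj₁ (transfer-other u≢t u≢s)

    transfer-count≥-above : ∀ j → m t < j → count≥ j (transfer m t s) ≡ count≥ j m
    transfer-count≥-above j mt<j = sum-cong-≗ same
      where
      same : ∀ u → atLeast j (transfer m t s u) ≡ atLeast j (m u)
      same u with transfer-values u
      ... | inj₁ unchanged       = cong (atLeast j) unchanged
      ... | inj₂ (yu<mt , mu≤mt) =
        trans (atLeast-< (<-trans yu<mt mt<j)) (sym (atLeast-< (≤-<-trans mu≤mt mt<j)))

    transfer-count≥-drop : count≥ (m t) (transfer m t s) < count≥ (m t) m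
    transfer-count≥-drop = sum-mono-< le t lt
      where
      le : ∀ u → atLeast (m t) (transfer m t s u) ≤ atLeast (m t) (m u)
      le u with transfer-values u
      ... | inj₁ unchanged   = ≤-reflexive (cong (atLeast (m t)) unchanged)
      ... | inj₂ (yu<mt , _) = subst (_≤ _) (sym (atLeast-< yu<mt)) atLeast-nonneg
      lt : atLeast (m t) (transfer m t s t) < atLeast (m t) (m t)
      lt rewrite transfer-source t≢s | atLeast-< {m t} (i≤pred[j]⇒i<j {pred (m t)} ≤-refl)
               | atLeast-≤ {m t} {m t} ≤-refl = +<+ (s≤s z≤n)

module _ {p : Subset n → ℤ∞} where

  transfer-InB : ∀ {m t s} → InB p m → (∀ Z → ¬ (Tight p m Z × t ∈ Z × s ∉ Z)) →
    InB p (transfer m t s)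
  transfer-InB {m} {t} {s} (total , lower) unseparated = total′ , lower′
    where
    y : Fin n → ℤ
    y = transfer m t s
    balance : ∀ Z {a b} → χ Z t ≡ a → χ Z s ≡ b → a + sumOver Z y ≡ b + sumOver Z m
    balance Z refl refl = sumOver-transfer Z m t s
    total′ : p ⊤ ≡ fin (sumOver ⊤ y)
    total′ = trans total (cong fin (sym (∙-cancelˡ 1ℤ _ _ (balance ⊤ (χ-∈ (∈⊤ {x = t})) (χ-∈ (∈⊤ {x = s}))))))
    lower′ : ∀ Z → p Z ≤∞ fin (sumOver Z y)
    lower′ Z with t ∈? Z | s ∈? Z
    ... | yes t∈Z | yes s∈Z = subst (λ v → p Z ≤∞ fin v)
      (sym (∙-cancelˡ 1ℤ _ _ (balance Z (χ-∈ t∈Z) (χ-∈ s∈Z)))) (lower Z)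
    ... | yes t∈Z | no  s∉Z = ≤∞-fin-suc (subst (λ v → p Z ≤∞ fin v) mZ≡1+yZ (lower Z))
      (λ pZ≡1+yZ → unseparated Z (trans pZ≡1+yZ (cong fin (sym mZ≡1+yZ)) , t∈Z , s∉Z))
      where
      mZ≡1+yZ : sumOver Z m ≡ sucℤ (sumOver Z y)
      mZ≡1+yZ = sym (trans (balance Z (χ-∈ t∈Z) (χ-∉ s∉Z)) (+-identityˡ _))
    ... | no  t∉Z | yes s∈Z = ≤∞-fin-trans (lower Z)
      (≤-trans (i≤suc[i] _) (≤-reflexive (trans (sym (balance Z (χ-∉ t∉Z) (χ-∈ s∈Z))) (+-identityˡ _))))
    ... | no  t∉Z | no  s∉Z = subst (λ v → p Z ≤∞ fin v)
      (sym (∙-cancelˡ 0ℤ _ _ (balance Z (χ-∉ t∉Z) (χ-∉ s∉Z)))) (lower Z)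

  -- Otherwise moving one unit from t to s stays in B and lowers the count at level m t.
  decMin-separates : ∀ {m t s} → DecMin p m → sucℤ (m s) < m t →
    ∃ λ Z → Tight p m Z × t ∈ Z × s ∉ Z
  decMin-separates {m} {t} {s} dm@(inB , _) ms<mt
    with anySubset? (λ Z → ≡fin? (p Z) (sumOver Z m) ×-dec (t ∈? Z ×-dec ¬? (s ∈? Z)))
  ... | yes separated   = separated
  ... | no  unseparated = ⊥-elim (decMin-noCountDrop dm
        (transfer-InB inB (λ Z sep → unseparated (Z , sep))) (m t)
        (transfer-count≥-above {m = m} ms<mt) (transfer-count≥-drop {m = m} ms<mt))

  decMin-smallestTight-β≤suc : ∀ {m β C} → IsAdmissible p → DecMin p m → SmallestTight p m (λ s → β ≤ m s) C →
    ∀ s → s ∈ C → β ≤ sucℤ (m s)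
  decMin-smallestTight-β≤suc {m} {β} adm dm@(inB , _) C-least s s∈C with β ≤? sucℤ (m s)
  ... | yes β≤1+ms = β≤1+ms
  ... | no  β≰1+ms = ⊥-elim (smallestTight-∌ adm inB (λ t → β ≤? m t) C-least
        (λ t β≤mt → decMin-separates dm (<-≤-trans (≰⇒> β≰1+ms) β≤mt)) s∈C)

-- Uniqueness of one level of the chain

record Layer (m : Fin n → ℤ) (D : Subset n) (β : ℤ) : Set where
  field
    above    : ∀ s → s ∈ D → β ≤ m s
    below    : ∀ s → s ∉ D → m s ≤ β
    attained : ∃ λ s → s ∉ D × m s ≡ β

size : Subset n → ℤ
size D = sum (χ D)

module _ {m : Fin n → ℤ} {D β} (L : Layer m D β) where
  open Layer L

  layer-count≥-≤size : ∀ {k} → β < k → count≥ k m ≤ size D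
  layer-count≥-≤size {k} β<k = sum-mono-≤ le
    where
    le : ∀ s → atLeast k (m s) ≤ χ D s
    le s with s ∈? D
    ... | yes s∈D = subst (atLeast k (m s) ≤_) (sym (χ-∈ s∈D)) atLeast-≤1
    ... | no  s∉D = ≤-reflexive (trans (atLeast-< (≤-<-trans (below s s∉D) β<k)) (sym (χ-∉ s∉D)))

  layer-size<count≥ : ∀ {k} → k ≤ β → size D < count≥ k m
  layer-size<count≥ {k} k≤β = sum-mono-< le s₀ lt
    where
    s₀ : Fin n
    s₀ = proj₁ attained
    le : ∀ s → χ D s ≤ atLeast k (m s)
    le s with s ∈? D
    ... | yes s∈D = ≤-reflexive (trans (χ-∈ s∈D) (sym (atLeast-≤ (≤-trans k≤β (above s s∈D)))))
    ... | no  s∉D = subst (_≤ atLeast k (m s)) (sym (χ-∉ s∉D)) atLeast-nonneg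
    lt : χ D s₀ < atLeast k (m s₀)
    lt rewrite χ-∉ (proj₁ (proj₂ attained))
             | atLeast-≤ {k} (subst (k ≤_) (sym (proj₂ (proj₂ attained))) k≤β) = +<+ (s≤s z≤n)

-- β is the largest k with size D < count≥ k m.
layer-threshold-≤ : ∀ {m m′ : Fin n → ℤ} {D β β′} → (∀ k → count≥ k m ≡ count≥ k m′) →
  Layer m D β → Layer m′ D β′ → β ≤ β′
layer-threshold-≤ {D = D} {β} same L L′ = ≮⇒≥ λ β′<β →
  ≤⇒≯ (layer-count≥-≤size L′ β′<β) (subst (size D <_) (same β) (layer-size<count≥ L ≤-refl))

layer-threshold-unique : ∀ {m m′ : Fin n → ℤ} {D β β′} → (∀ k → count≥ k m ≡ count≥ k m′) →
  Layer m D β → Layer m′ D β′ → β ≡ β′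
layer-threshold-unique same L L′ =
  ≤-antisym (layer-threshold-≤ same L L′) (layer-threshold-≤ (λ k → sym (same k)) L′ L)

module _ {p : Subset n → ℤ∞} {m m′ : Fin n → ℤ} {D C : Subset n} {β : ℤ} where

  smallestTight-transfer : InB p m′ → Layer m D β → Layer m′ D β →
    sumOver D m ≡ sumOver D m′ → count≥ β m ≡ count≥ β m′ →
    SmallestTight p m (λ s → β ≤ m s) C → (∀ s → s ∈ C → β ≤ sucℤ (m s)) →
    Tight p m′ C × (∀ s → β ≤ m′ s → s ∈ C)
  smallestTight-transfer (_ , lower′) L L′ mD≡m′D count≡ C-least@(tightC , ⊇β≤m , _) spread =
    tight′ , ⊇β≤m′
    where
    open Layer
    -- Lhs ≤ Rhs pointwise, strictly at any s ∉ C with β ≤ m′ s; summing and cancelling the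
    -- equal terms m(D) = m′(D) and count≥ β m = count≥ β m′ leaves m′(C) ≤ m(C), strictly if
    -- such an s exists.
    Lhs Rhs : Fin n → ℤ
    Lhs s = atLeast β (m s) + (restrict D m s + restrict C m′ s)
    Rhs s = atLeast β (m′ s) + (restrict D m′ s + restrict C m s)

    sum-split : ∀ f g → sum (λ s → atLeast β (f s) + (restrict D f s + restrict C g s)) ≡
                        count≥ β f + (sumOver D f + sumOver C g)
    sum-split f g = trans (∑-distrib-+ (λ s → atLeast β (f s)) _)
      (cong (count≥ β f +_) (trans (∑-distrib-+ (restrict D f) (restrict C g))
        (sym (cong₂ _+_ (sumOver-restrict D f) (sumOver-restrict C g)))))

    D⊆C : ∀ {s} → s ∈ D → s ∈ C
    D⊆C {s} s∈D = ⊇β≤m s (above L s s∈D)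

    Lhs≤Rhs : ∀ s → Lhs s ≤ Rhs s
    Lhs≤Rhs s with s ∈? D | s ∈? C
    ... | yes s∈D | _
      rewrite restrict-∈ m s∈D | restrict-∈ m′ s∈D | restrict-∈ m (D⊆C s∈D) | restrict-∈ m′ (D⊆C s∈D)
            | atLeast-≤ (above L s s∈D) | atLeast-≤ (above L′ s s∈D)
      = ≤-reflexive (cong (1ℤ +_) (+-comm (m s) (m′ s)))
    ... | no  s∉D | yes s∈C
      rewrite restrict-∉ m s∉D | restrict-∉ m′ s∉D | restrict-∈ m s∈C | restrict-∈ m′ s∈C
            | +-identityˡ (m s) | +-identityˡ (m′ s)
      = atLeast-exchange (below L′ s s∉D) (spread s s∈C)
    ... | no  s∉D | no  s∉C
      rewrite restrict-∉ m s∉D | restrict-∉ m′ s∉D | restrict-∉ m s∉C | restrict-∉ m′ s∉C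
            | atLeast-< (smallestTight-∉⇒< C-least s∉C)
      = +-mono-≤ (atLeast-nonneg {β} {m′ s}) (≤-refl {0ℤ})

    Lhs<Rhs : ∀ s → s ∉ C → β ≤ m′ s → Lhs s < Rhs s
    Lhs<Rhs s s∉C β≤m′s
      rewrite restrict-∉ m (s∉C ∘ D⊆C) | restrict-∉ m′ (s∉C ∘ D⊆C)
            | restrict-∉ m s∉C | restrict-∉ m′ s∉C | atLeast-< (smallestTight-∉⇒< C-least s∉C) | atLeast-≤ β≤m′s
      = +<+ (s≤s z≤n)

    cancel-≤ : ∀ {a b} → count≥ β m + (sumOver D m + a) ≤ count≥ β m′ + (sumOver D m′ + b) → a ≤ b
    cancel-≤ h rewrite count≡ | mD≡m′D = +-cancelˡ-≤ (sumOver D m′) (+-cancelˡ-≤ (count≥ β m′) h)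

    cancel-< : ∀ {a b} → count≥ β m + (sumOver D m + a) < count≥ β m′ + (sumOver D m′ + b) → a < b
    cancel-< h rewrite count≡ | mD≡m′D = +-cancelˡ-< (sumOver D m′) (+-cancelˡ-< (count≥ β m′) h)

    m′C≤mC : sumOver C m′ ≤ sumOver C m
    m′C≤mC = cancel-≤ (subst₂ _≤_ (sum-split m m′) (sum-split m′ m) (sum-mono-≤ Lhs≤Rhs))

    mC≤m′C : sumOver C m ≤ sumOver C m′
    mC≤m′C = drop‿fin≤fin (subst (_≤∞ fin (sumOver C m′)) tightC (lower′ C))

    tight′ : Tight p m′ C
    tight′ = trans tightC (cong fin (≤-antisym mC≤m′C m′C≤mC))

    ⊇β≤m′ : ∀ s → β ≤ m′ s → s ∈ C
    ⊇β≤m′ s β≤m′s with s ∈? C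
    ... | yes s∈C = s∈C
    ... | no  s∉C = ⊥-elim (≤⇒≯ mC≤m′C (cancel-<
      (subst₂ _<_ (sum-split m m′) (sum-split m′ m) (sum-mono-< Lhs≤Rhs s (Lhs<Rhs s s∉C β≤m′s)))))

smallestTight-⊆ : ∀ {p : Subset n → ℤ∞} {m m′ D β C C′} → IsAdmissible p →
  DecMin p m → DecMin p m′ → Tight p m D → Tight p m′ D → Layer m D β → Layer m′ D β →
  SmallestTight p m (λ s → β ≤ m s) C → SmallestTight p m′ (λ s → β ≤ m′ s) C′ → C′ ⊆ C
smallestTight-⊆ adm dm dm′ tD tD′ L L′ C-least (_ , _ , C′-least) =
  let C-tight′ , ⊇β≤m′ = smallestTight-transfer (proj₁ dm′) L L′ (fin-injective (trans (sym tD) tD′))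
                           (decMin-count≥-≡ dm dm′ _) C-least (decMin-smallestTight-β≤suc adm dm C-least)
  in C′-least _ C-tight′ ⊇β≤m′

level-unique : ∀ {p : Subset n → ℤ∞} {m m′ D β β′ C C′} → IsAdmissible p →
  DecMin p m → DecMin p m′ → Tight p m D → Tight p m′ D → Layer m D β → Layer m′ D β′ →
  SmallestTight p m (λ s → β ≤ m s) C → SmallestTight p m′ (λ s → β′ ≤ m′ s) C′ →
  C ≡ C′ × β ≡ β′
level-unique adm dm dm′ tD tD′ L L′ C-least C′-least
  with layer-threshold-unique (decMin-count≥-≡ dm dm′) L L′
... | refl = ⊆-antisym (smallestTight-⊆ adm dm′ dm tD′ tD L′ L C′-least C-least)
                       (smallestTight-⊆ adm dm dm′ tD tD′ L L′ C-least C′-least) , refl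

preceding : (ℕ → Subset n) → ℕ → Subset n
preceding C zero    = ⊥
preceding C (suc i) = C i

SmallestTight-map : ∀ {p : Subset n → ℤ∞} {m} {P Q : Fin n → Set} {C} →
  (∀ s → P s → Q s) → (∀ s → Q s → P s) → SmallestTight p m P C → SmallestTight p m Q C
SmallestTight-map P⇒Q Q⇒P (tight , ⊇P , least) =
  tight , (λ s → ⊇P s ∘ Q⇒P s) , (λ T tT ⊇Q → least T tT (λ s → ⊇Q s ∘ P⇒Q s))

module _ {p : Subset n → ℤ∞} (adm : IsAdmissible p) {m q C β} (dm : DecMin p m)
         (chain : IsChain p m q C β) where
  open IsChain chain

  chain-smallestTight : ∀ i → i <ℕ q → SmallestTight p m (λ s → β i ≤ m s) (C i)
  chain-smallestTight zero    _   = SmallestTight-map (λ s ms≡β → ≤-reflexive (sym ms≡β))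
    (λ s β≤ms → ≤-antisym (proj₂ β-first s ∈⊤) β≤ms) C-first
  chain-smallestTight (suc i) i<q = C-step i i<q

  chain-preceding-tight : ∀ i → i <ℕ q → Tight p m (preceding C i)
  chain-preceding-tight zero    _   = tight-⊥ adm m
  chain-preceding-tight (suc i) i<q = proj₁ (chain-smallestTight i (ℕ.<⇒≤ i<q))

  chain-layer : ∀ i → i <ℕ q → Layer m (preceding C i) (β i)
  chain-layer zero _ = record
    { above    = λ s s∈⊥ → ⊥-elim (∉⊥ s∈⊥)
    ; below    = λ s _ → proj₂ β-first s ∈⊤
    ; attained = let s , _ , ms≡β = proj₁ β-first in s , ∉⊥ , ms≡β
    }
  chain-layer (suc i) i+1<q = record
    { above    = above
    ; below    = proj₂ (β-step i i+1<q)
    ; attained = proj₁ (β-step i i+1<q)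
    }
    where
    Cᵢ-least : SmallestTight p m (λ s → β i ≤ m s) (C i)
    Cᵢ-least = chain-smallestTight i (ℕ.<⇒≤ i+1<q)
    above : ∀ s → s ∈ C i → β (suc i) ≤ m s
    above s s∈Cᵢ with proj₁ (β-step i i+1<q)
    ... | t , t∉Cᵢ , mt≡β = +-cancelˡ-≤ 1ℤ (≤-trans
          (subst (λ v → sucℤ v ≤ β i) mt≡β (i<j⇒suc[i]≤j (smallestTight-∉⇒< Cᵢ-least t∉Cᵢ)))
          (decMin-smallestTight-β≤suc adm dm Cᵢ-least s s∈Cᵢ))

module _ {p : Subset n → ℤ∞} (adm : IsAdmissible p) {m m′ q q′ C C′ β β′}
         (dm : DecMin p m) (dm′ : DecMin p m′)
         (chain : IsChain p m q C β) (chain′ : IsChain p m′ q′ C′ β′) where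

  level-agree : ∀ i → i <ℕ q → i <ℕ q′ → preceding C i ≡ preceding C′ i → C i ≡ C′ i × β i ≡ β′ i
  level-agree i i<q i<q′ D≡D′ = level-unique adm dm dm′
    (chain-preceding-tight adm dm chain i i<q)
    (subst (Tight p m′) (sym D≡D′) (chain-preceding-tight adm dm′ chain′ i i<q′))
    (chain-layer adm dm chain i i<q)
    (subst (λ D → Layer m′ D (β′ i)) (sym D≡D′) (chain-layer adm dm′ chain′ i i<q′))
    (chain-smallestTight adm dm chain i i<q) (chain-smallestTight adm dm′ chain′ i i<q′)

  chains-agree : ∀ i → i <ℕ q → i <ℕ q′ → C i ≡ C′ i × β i ≡ β′ i
  chains-agree zero    0<q   0<q′   = level-agree zero 0<q 0<q′ refl
  chains-agree (suc i) i+1<q i+1<q′ = level-agree (suc i) i+1<q i+1<q′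
    (proj₁ (chains-agree i (ℕ.<⇒≤ i+1<q) (ℕ.<⇒≤ i+1<q′)))

chain-length-≤ : ∀ {p : Subset n → ℤ∞} {m m′ q q′ C C′ β β′} →
  IsChain p m q C β → IsChain p m′ q′ C′ β′ → (∀ i → i <ℕ q → i <ℕ q′ → C i ≡ C′ i) → q ≤ℕ q′
chain-length-≤ {q′ = zero}  _     chain′ _     with IsChain.q-pos chain′
... | ()
chain-length-≤ {q′ = suc k} chain chain′ agree = ℕ.≮⇒≥ λ k+1<q →
  IsChain.C-notS chain k k+1<q (trans (agree k (ℕ.<⇒≤ k+1<q) (ℕ.n<1+n k)) (IsChain.C-last chain′))

theorem5p7 : (n : ℕ) (p : Subset (suc n) → ℤ∞) → IsAdmissible p →
    (m m′ : Fin (suc n) → ℤ) → DecMin p m → DecMin p m′ →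
    (q q′ : ℕ) (C C′ : ℕ → Subset (suc n)) (β β′ : ℕ → ℤ) →
    IsChain p m q C β → IsChain p m′ q′ C′ β′ →
    (q ≡ q′) × (∀ i → i <ℕ q → (C i ≡ C′ i) × (β i ≡ β′ i))
theorem5p7 n p adm m m′ dm dm′ q q′ C C′ β β′ chain chain′ =
  q≡q′ , λ i i<q → agree i i<q (subst (i <ℕ_) q≡q′ i<q)
  where
  agree : ∀ i → i <ℕ q → i <ℕ q′ → C i ≡ C′ i × β i ≡ β′ i
  agree = chains-agree adm dm dm′ chain chain′
  q≡q′ : q ≡ q′
  q≡q′ = ℕ.≤-antisym (chain-length-≤ chain chain′ (λ i i<q i<q′ → proj₁ (agree i i<q i<q′)))
                      (chain-length-≤ chain′ chain (λ i i<q′ i<q → sym (proj₁ (agree i i<q i<q′))))
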